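{- There exists an absolute constant $C>0$ such that the following holds. Let $\mathbb{F}_q$ be a finite field with $q$ elements, let $A\subset \mathbb{F}_q$, and put $m_1=|A+A|$ and $m_2=|A\cdot A|$. Then $$|A|^3\le C\left(q^{ -1}m_1^2m_2|A|+q^{1/2}m_1m_2\right).$$ In particular, for any constants $c_1,c_2>0$ there is a constant $c>0$ such that if $c_1q^{1/2}\le |A|\le c_2 q^{7/10}$, then $$\max\{|A+A|,|A\cdot A|\}\ge c\,\frac{|A|^{3/2}}{q^{1/4}}.$$
   Context: $A+A=\{a+a':a,a'\in A\}$ and $A\cdot A=\{aa':a,a'\in A\}$; $|S|$ denotes the cardinality of a finite set $S$. -}

module Defs where

open import Data.Nat using (ℕ; zero; suc)
open import Data.Bool using (Bool; true; false; _∧_; _∨_)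
open import Data.Fin using (Fin; zero; suc)
import Data.Fin as Fin
open import Data.Fin.Subset using (Subset)
open import Data.Vec using (tabulate; lookup)
open import Data.Product using (∃)
open import Relation.Binary.PropositionalEquality using (_≡_; _≢_)
open import Relation.Nullary.Decidable using (⌊_⌋)
open import Algebra.Core using (Op₁; Op₂)
open import Algebra.Structures using (IsCommutativeRing)
open import Function.Bundles using (_↔_; Inverse)

record FiniteField : Set₁ where
  infixl 6 _+_
  infixl 7 _*_
  field
    Carrier : Set
    _+_ _*_ : Op₂ Carrier
    -_ : Op₁ Carrier
    0# 1# : Carrier
    isCommutativeRing : IsCommutativeRing _≡_ _+_ _*_ -_ 0# 1#
    0≢1 : 0# ≢ 1#
    inverse : ∀ x → x ≢ 0# → ∃ λ y → x * y ≡ 1#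
    q : ℕ
    enum : Fin q ↔ Carrier

anyFin : ∀ {n} → (Fin n → Bool) → Bool
anyFin {zero} f = false
anyFin {suc n} f = f zero ∨ anyFin (λ i → f (suc i))

module _ (F : FiniteField) where
  open FiniteField F
  open Inverse enum using (to; from)

  -- Subsets of F are represented as subsets of Fin q via the enumeration:
  -- the subset A ⊆ Fin q stands for { to i : i ∈ A } ⊆ F.
  -- A ⊙ A = { a ⊙ a' : a, a' ∈ A } for a binary operation ⊙ on F.
  opSet : Op₂ Carrier → Subset q → Subset q
  opSet _⊙_ A = tabulate λ k → anyFin λ i → anyFin λ j →
    lookup A i ∧ lookup A j ∧ ⌊ from (to i ⊙ to j) Fin.≟ k ⌋

  sumset : Subset q → Subset q
  sumset = opSet _+_

  prodset : Subset q → Subset q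
  prodset = opSet _*_

-- Write S = A + A, T = A · A, N = ∣S∣ ∣T∣, and count incidences between the grid S × T and the
-- q² lines v = s u + t. The numbers n(s,t) of grid points on the lines satisfy Σ n = q N and,
-- since two points with distinct abscissae lie on exactly one line, Σ n² ≤ q N + N²; hence
-- Σ (q n − N)² ≤ q³ N. For b ∈ A and c ∈ A ∖ {0} the line v = c (u − b) contains the ∣A∣ points
-- (a + b, c a), and these ∣A∣ ∣A ∖ {0}∣ lines are distinct, so ∣A∣ ∣A ∖ {0}∣ (q ∣A∣ − N)² ≤ q³ N.
-- Since ∣A∣ ≤ ∣S∣, ∣T∣ this rearranges to the first estimate with C = 2. The second part
-- compares the two terms of that estimate.

module Submission where

open import Defs
open import Data.Nat using (ℕ; _+_; _*_; _∸_; _^_; _≤_; _<_; _⊔_)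
open import Data.Product using (Σ; ∃; _×_)
open import Data.Fin.Subset using (Subset; ∣_∣)

open import Algebra.Bundles using (CommutativeRing)
import Algebra.Properties.Ring as RingProperties
import Algebra.Properties.Semiring.Sum as SemiringSum
open import Data.Bool.Base using (Bool; true; _∧_; _∨_; if_then_else_)
open import Data.Bool.Properties using (∨-zeroʳ)
open import Data.Fin.Base using (Fin; zero; suc)
import Data.Fin.Properties as Fin
open import Data.Fin.Subset using (inside; outside; _∈_; _∉_; _─_; ⁅_⁆; Nonempty; Empty)
open import Data.Fin.Subset.Properties
  using (_∈?_; nonempty?; Empty-unique; ∣⊥∣≡0; x∈⁅x⁆; x∉⁅y⁆⇒x≢y; ∣⁅x⁆∣≡1; p─q⊆p; x∈p⇒∣p-x∣<∣p∣)
open import Data.Nat.Base using (zero; suc; z≤n; s≤s; ∣_-_∣; NonZero; >-nonZero; >-nonZero⁻¹)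
open import Data.Nat.Properties hiding (_≟_)
open import Data.Nat.Solver using (module +-*-Solver)
open import Data.Nat.Tactic.RingSolver using (solve-∀)
open import Data.Product using (_,_)
open import Data.Sum.Base using (_⊎_; inj₁; inj₂; [_,_]′)
open import Data.Vec.Base using (_∷_; []; there; lookup)
open import Data.Vec.Properties using (lookup∘tabulate; []=⇒lookup; lookup⇒[]=)
open import Function.Base using (_∘_)
open import Function.Bundles using (_↔_; Inverse; mk↔ₛ′)
open import Function.Properties.Inverse using (↔-sym; ↔-trans; ↔⇒↣)
open import Relation.Binary.Definitions using (DecidableEquality)
open import Relation.Binary.PropositionalEquality
  using (_≡_; _≢_; refl; sym; trans; cong; cong₂; subst; module ≡-Reasoning)
open import Relation.Nullary.Decidable using (Dec; does; yes; no; via-injection; dec-true; ⌊_⌋; isYes≗does)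
open import Relation.Nullary.Negation using (contradiction)

open +-*-Solver using (solve; _:+_; _:*_; _:^_; _:=_; con)
open SemiringSum +-*-semiring
  using (sum; sum-cong-≋; ∑-distrib-+; sum-permute; *-distribˡ-sum; *-distribʳ-sum)
  renaming (∑-comm to sum-comm)

∣m-n∣^2+2mn≡m^2+n^2 : ∀ m n → ∣ m - n ∣ ^ 2 + 2 * (m * n) ≡ m ^ 2 + n ^ 2
∣m-n∣^2+2mn≡m^2+n^2 m n = [ ordered , flipped ]′ (≤-total m n)
  where
  ordered : ∀ {m n} → m ≤ n → ∣ m - n ∣ ^ 2 + 2 * (m * n) ≡ m ^ 2 + n ^ 2
  ordered {m} m≤n with d , refl ← m≤n⇒∃[o]m+o≡n m≤n
    rewrite m≤n⇒∣m-n∣≡n∸m m≤n | m+n∸m≡n m d =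
    solve 2 (λ m d → d :^ 2 :+ con 2 :* (m :* (m :+ d)) := m :^ 2 :+ (m :+ d) :^ 2) refl m d

  flipped : n ≤ m → ∣ m - n ∣ ^ 2 + 2 * (m * n) ≡ m ^ 2 + n ^ 2
  flipped n≤m = begin
    ∣ m - n ∣ ^ 2 + 2 * (m * n) ≡⟨ cong₂ (λ a b → a ^ 2 + 2 * b) (∣-∣-comm m n) (*-comm m n) ⟩
    ∣ n - m ∣ ^ 2 + 2 * (n * m) ≡⟨ ordered n≤m ⟩
    n ^ 2 + m ^ 2               ≡⟨ +-comm (n ^ 2) (m ^ 2) ⟩
    m ^ 2 + n ^ 2               ∎
    where open ≡-Reasoning

^-cancelˡ-≤ : ∀ n .{{_ : NonZero n}} {m o} → m ^ n ≤ o ^ n → m ≤ o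
^-cancelˡ-≤ n mⁿ≤oⁿ = ≮⇒≥ λ o<m → <⇒≱ (^-monoˡ-< n o<m) mⁿ≤oⁿ

square-∸-dichotomy : ∀ {y z R} → (y ∸ z) ^ 2 ≤ R → y ≤ 2 * z ⊎ y ^ 2 ≤ 4 * R
square-∸-dichotomy {y} {z} {R} h with y ≤? 2 * z
... | yes y≤2z = inj₁ y≤2z
... | no  y≰2z = inj₂ (begin
  y ^ 2             ≤⟨ ^-monoˡ-≤ 2 y≤2[y∸z] ⟩
  (2 * (y ∸ z)) ^ 2 ≡⟨ solve 1 (λ d → (con 2 :* d) :^ 2 := con 4 :* d :^ 2) refl (y ∸ z) ⟩
  4 * (y ∸ z) ^ 2   ≤⟨ *-monoʳ-≤ 4 h ⟩
  4 * R             ∎)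
  where
  open ≤-Reasoning
  z+z≤y : z + z ≤ y
  z+z≤y = ≤-trans (≤-reflexive (cong (z +_) (sym (+-identityʳ z)))) (<⇒≤ (≰⇒> y≰2z))
  y≤2[y∸z] : y ≤ 2 * (y ∸ z)
  y≤2[y∸z] = begin
    y                   ≡⟨ m∸n+n≡m (≤-trans (m≤n+m z z) z+z≤y) ⟨
    y ∸ z + z           ≤⟨ +-monoʳ-≤ (y ∸ z) (m+n≤o⇒m≤o∸n z z+z≤y) ⟩
    y ∸ z + (y ∸ z)     ≡⟨ cong (y ∸ z +_) (+-identityʳ (y ∸ z)) ⟨
    2 * (y ∸ z)         ∎

xye²≤q³N⇒x²e²≤2q³N : ∀ {q x y N} → x * y * (q * x ∸ N) ^ 2 ≤ q ^ 3 * N → x ≤ y + 1 → x ^ 2 ≤ N →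
                     x ^ 2 * (q * x ∸ N) ^ 2 ≤ 2 * (q ^ 3 * N)
xye²≤q³N⇒x²e²≤2q³N {x = zero}  {zero}      _ _ _ = z≤n
xye²≤q³N⇒x²e²≤2q³N {q} {1}     {zero} {N}  _ _ 1≤N = begin
  1 ^ 2 * (q * 1 ∸ N) ^ 2 ≤⟨ *-monoʳ-≤ 1 (^-monoˡ-≤ 2 (m∸n≤m (q * 1) N)) ⟩
  1 ^ 2 * (q * 1) ^ 2     ≡⟨ solve 1 (λ q → con 1 :^ 2 :* (q :* con 1) :^ 2 := q :^ 2) refl q ⟩
  q ^ 2                   ≤⟨ q²≤q³ q ⟩
  q ^ 3                   ≡⟨ *-identityʳ (q ^ 3) ⟨
  q ^ 3 * 1               ≤⟨ *-monoʳ-≤ (q ^ 3) 1≤N ⟩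
  q ^ 3 * N               ≤⟨ m≤m+n (q ^ 3 * N) _ ⟩
  2 * (q ^ 3 * N)         ∎
  where
  open ≤-Reasoning
  q²≤q³ : ∀ q → q ^ 2 ≤ q ^ 3
  q²≤q³ zero        = z≤n
  q²≤q³ q@(suc _)   = ^-monoʳ-≤ q (n≤1+n 2)
xye²≤q³N⇒x²e²≤2q³N {x = suc (suc _)} {zero} _ (s≤s ()) _
xye²≤q³N⇒x²e²≤2q³N {q} {x} {y@(suc _)} {N} bound x≤y+1 _ = begin
  x ^ 2 * e ^ 2           ≤⟨ *-monoˡ-≤ (e ^ 2) x²≤2xy ⟩
  2 * (x * y) * e ^ 2     ≡⟨ *-assoc 2 (x * y) (e ^ 2) ⟩
  2 * (x * y * e ^ 2)     ≤⟨ *-monoʳ-≤ 2 bound ⟩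
  2 * (q ^ 3 * N)         ∎
  where
  open ≤-Reasoning
  e = q * x ∸ N
  x≤2y : x ≤ 2 * y
  x≤2y = ≤-trans x≤y+1 (+-monoʳ-≤ y (s≤s z≤n))
  x²≤2xy : x ^ 2 ≤ 2 * (x * y)
  x²≤2xy = begin
    x ^ 2          ≡⟨ cong (x *_) (*-identityʳ x) ⟩
    x * x          ≤⟨ *-monoʳ-≤ x x≤2y ⟩
    x * (2 * y)    ≡⟨ solve 2 (λ x y → x :* (con 2 :* y) := con 2 :* (x :* y)) refl x y ⟩
    2 * (x * y)    ∎

x²e²≤2q³N⇒estimate : ∀ {q x m₁ m₂} → x ≤ m₁ → x ^ 2 ≤ m₁ * m₂ →
                     x ^ 2 * (q * x ∸ m₁ * m₂) ^ 2 ≤ 2 * (q ^ 3 * (m₁ * m₂)) →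
                     (q * x ^ 3 ∸ 2 * (m₁ ^ 2 * m₂ * x)) ^ 2 ≤ (2 * (m₁ * m₂ * q)) ^ 2 * q
x²e²≤2q³N⇒estimate {q} {x} {m₁} {m₂} x≤m₁ x²≤N bound = begin
  (q * x ^ 3 ∸ 2 * (m₁ ^ 2 * m₂ * x)) ^ 2
    ≤⟨ ^-monoˡ-≤ 2 (≤-trans (∸-monoʳ-≤ (q * x ^ 3) x²N≤) (≤-reflexive factor)) ⟩
  (x ^ 2 * (q * x ∸ N)) ^ 2
    ≡⟨ solve 2 (λ a e → (a :* e) :^ 2 := a :* (a :* e :^ 2)) refl (x ^ 2) (q * x ∸ N) ⟩
  x ^ 2 * (x ^ 2 * (q * x ∸ N) ^ 2)
    ≤⟨ *-mono-≤ x²≤N bound ⟩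
  N * (2 * (q ^ 3 * N))
    ≤⟨ m≤m+n _ _ ⟩
  2 * (N * (2 * (q ^ 3 * N)))
    ≡⟨ solve 2 (λ N q → con 2 :* (N :* (con 2 :* (q :^ 3 :* N))) := (con 2 :* (N :* q)) :^ 2 :* q) refl N q ⟩
  (2 * (N * q)) ^ 2 * q ∎
  where
  open ≤-Reasoning
  N = m₁ * m₂
  x²N≤ : x ^ 2 * N ≤ 2 * (m₁ ^ 2 * m₂ * x)
  x²N≤ = begin
    x ^ 2 * N             ≡⟨ solve 3 (λ x m₁ m₂ → x :^ 2 :* (m₁ :* m₂) := x :* m₁ :* m₂ :* x) refl x m₁ m₂ ⟩
    x * m₁ * m₂ * x       ≤⟨ *-monoˡ-≤ x (*-monoˡ-≤ m₂ (*-monoˡ-≤ m₁ x≤m₁)) ⟩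
    m₁ * m₁ * m₂ * x      ≡⟨ solve 3 (λ x m₁ m₂ → m₁ :* m₁ :* m₂ :* x := m₁ :^ 2 :* m₂ :* x) refl x m₁ m₂ ⟩
    m₁ ^ 2 * m₂ * x       ≤⟨ m≤m+n _ _ ⟩
    2 * (m₁ ^ 2 * m₂ * x) ∎
  factor : q * x ^ 3 ∸ x ^ 2 * N ≡ x ^ 2 * (q * x ∸ N)
  factor = begin-equality
    q * x ^ 3 ∸ x ^ 2 * N
      ≡⟨ cong (_∸ x ^ 2 * N) (solve 2 (λ q x → q :* x :^ 3 := x :^ 2 :* (q :* x)) refl q x) ⟩
    x ^ 2 * (q * x) ∸ x ^ 2 * N
      ≡⟨ *-distribˡ-∸ (x ^ 2) (q * x) N ⟨
    x ^ 2 * (q * x ∸ N) ∎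

qx²≤4M³⇒b⁴x⁶≤[2ab]⁴M⁴q : ∀ {q x M a b} .{{_ : NonZero a}} .{{_ : NonZero b}} →
                      q * x ^ 2 ≤ 4 * M ^ 3 → b ^ 10 * x ^ 10 ≤ a ^ 10 * q ^ 7 →
                      b ^ 4 * x ^ 6 ≤ (2 * a * b) ^ 4 * M ^ 4 * q
qx²≤4M³⇒b⁴x⁶≤[2ab]⁴M⁴q {q} {x} {M} {a} {b} qx²≤4M³ bx≤aq = ^-cancelˡ-≤ 3 (begin
  (b ^ 4 * x ^ 6) ^ 3
    ≡⟨ solve 2 (λ b x → (b :^ 4 :* x :^ 6) :^ 3 := b :^ 2 :* x :^ 8 :* (b :^ 10 :* x :^ 10)) refl b x ⟩
  b ^ 2 * x ^ 8 * (b ^ 10 * x ^ 10)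
    ≤⟨ *-monoʳ-≤ (b ^ 2 * x ^ 8) bx≤aq ⟩
  b ^ 2 * x ^ 8 * (a ^ 10 * q ^ 7)
    ≡⟨ solve 4 (λ a b x q → b :^ 2 :* x :^ 8 :* (a :^ 10 :* q :^ 7)
                         := a :^ 10 :* b :^ 2 :* q :^ 3 :* (q :* x :^ 2) :^ 4) refl a b x q ⟩
  a ^ 10 * b ^ 2 * q ^ 3 * (q * x ^ 2) ^ 4
    ≤⟨ *-monoʳ-≤ (a ^ 10 * b ^ 2 * q ^ 3) (^-monoˡ-≤ 4 qx²≤4M³) ⟩
  a ^ 10 * b ^ 2 * q ^ 3 * (4 * M ^ 3) ^ 4
    ≡⟨ solve 4 (λ a b M q → a :^ 10 :* b :^ 2 :* q :^ 3 :* (con 4 :* M :^ 3) :^ 4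
                         := con 2 :^ 8 :* a :^ 10 :* b :^ 2 :* (M :^ 12 :* q :^ 3)) refl a b M q ⟩
  2 ^ 8 * a ^ 10 * b ^ 2 * (M ^ 12 * q ^ 3)
    ≤⟨ *-monoˡ-≤ (M ^ 12 * q ^ 3) coefficients ⟩
  2 ^ 12 * a ^ 12 * b ^ 12 * (M ^ 12 * q ^ 3)
    ≡⟨ solve 4 (λ a b M q → con 2 :^ 12 :* a :^ 12 :* b :^ 12 :* (M :^ 12 :* q :^ 3)
                         := ((con 2 :* a :* b) :^ 4 :* M :^ 4 :* q) :^ 3) refl a b M q ⟩
  ((2 * a * b) ^ 4 * M ^ 4 * q) ^ 3 ∎)
  where
  open ≤-Reasoning
  coefficients : 2 ^ 8 * a ^ 10 * b ^ 2 ≤ 2 ^ 12 * a ^ 12 * b ^ 12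
  coefficients = *-mono-≤ (*-mono-≤ (^-monoʳ-≤ 2 (m≤m+n 8 4)) (^-monoʳ-≤ a (m≤m+n 10 2))) (^-monoʳ-≤ b (m≤m+n 2 10))

x⁶≤16M⁴q⇒b⁴x⁶≤[2ab]⁴M⁴q : ∀ {q x M a b} .{{_ : NonZero a}} → x ^ 6 ≤ 16 * M ^ 4 * q →
                b ^ 4 * x ^ 6 ≤ (2 * a * b) ^ 4 * M ^ 4 * q
x⁶≤16M⁴q⇒b⁴x⁶≤[2ab]⁴M⁴q {q} {x} {M} {a} {b} x⁶≤16M⁴q = begin
  b ^ 4 * x ^ 6
    ≤⟨ *-monoʳ-≤ (b ^ 4) x⁶≤16M⁴q ⟩
  b ^ 4 * (16 * M ^ 4 * q)
    ≡⟨ solve 3 (λ b M q → b :^ 4 :* (con 16 :* M :^ 4 :* q)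
                       := (con 2 :* con 1 :* b) :^ 4 :* M :^ 4 :* q) refl b M q ⟩
  (2 * 1 * b) ^ 4 * M ^ 4 * q
    ≤⟨ *-monoˡ-≤ q (*-monoˡ-≤ (M ^ 4) (^-monoˡ-≤ 4 (*-monoˡ-≤ b (*-monoʳ-≤ 2 (>-nonZero⁻¹ a))))) ⟩
  (2 * a * b) ^ 4 * M ^ 4 * q ∎
  where open ≤-Reasoning

-- Either the q⁻¹ term or the q^{1/2} term of the estimate dominates; only the first case needs
-- the upper bound on x.
estimate⇒b⁴x⁶≤[2ab]⁴M⁴q : ∀ {q x M a b} .{{_ : NonZero a}} .{{_ : NonZero b}} →
                          (q * x ^ 3 ∸ 2 * (M ^ 3 * x)) ^ 2 ≤ (2 * (M ^ 2 * q)) ^ 2 * q →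
                          b ^ 10 * x ^ 10 ≤ a ^ 10 * q ^ 7 →
                          b ^ 4 * x ^ 6 ≤ (2 * a * b) ^ 4 * M ^ 4 * q
estimate⇒b⁴x⁶≤[2ab]⁴M⁴q {x = zero} {b = b} _ _ = ≤-trans (≤-reflexive (*-zeroʳ (b ^ 4))) z≤n
estimate⇒b⁴x⁶≤[2ab]⁴M⁴q {zero} {x@(suc _)} {a = a} {b} _ bx≤aq =
  contradiction (≤-trans (*-mono-≤ (m^n>0 b 10) (m^n>0 x 10)) (≤-trans bx≤aq (≤-reflexive (*-zeroʳ (a ^ 10)))))
                λ ()
estimate⇒b⁴x⁶≤[2ab]⁴M⁴q {q@(suc _)} {x@(suc _)} {M} estimate bx≤aq
  with square-∸-dichotomy {q * x ^ 3} {2 * (M ^ 3 * x)} estimate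
... | inj₁ qx³≤4M³x = qx²≤4M³⇒b⁴x⁶≤[2ab]⁴M⁴q {q} {x} {M} (*-cancelˡ-≤ x (begin
  x * (q * x ^ 2)
    ≡⟨ solve 2 (λ q x → x :* (q :* x :^ 2) := q :* x :^ 3) refl q x ⟩
  q * x ^ 3
    ≤⟨ qx³≤4M³x ⟩
  2 * (2 * (M ^ 3 * x))
    ≡⟨ solve 2 (λ M x → con 2 :* (con 2 :* (M :^ 3 :* x)) := x :* (con 4 :* M :^ 3)) refl M x ⟩
  x * (4 * M ^ 3) ∎)) bx≤aq
  where open ≤-Reasoning
... | inj₂ q²x⁶≤16M⁴q³ = x⁶≤16M⁴q⇒b⁴x⁶≤[2ab]⁴M⁴q {q} {x} {M} (*-cancelˡ-≤ (q ^ 2) {{m^n≢0 q 2}} (begin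
  q ^ 2 * x ^ 6
    ≡⟨ solve 2 (λ q x → q :^ 2 :* x :^ 6 := (q :* x :^ 3) :^ 2) refl q x ⟩
  (q * x ^ 3) ^ 2
    ≤⟨ q²x⁶≤16M⁴q³ ⟩
  4 * ((2 * (M ^ 2 * q)) ^ 2 * q)
    ≡⟨ solve 2 (λ M q → con 4 :* ((con 2 :* (M :^ 2 :* q)) :^ 2 :* q)
                     := q :^ 2 :* (con 16 :* M :^ 4 :* q)) refl M q ⟩
  q ^ 2 * (16 * M ^ 4 * q) ∎))
  where open ≤-Reasoning

estimate-⊔ : ∀ {q x m₁ m₂} → (q * x ^ 3 ∸ 2 * (m₁ ^ 2 * m₂ * x)) ^ 2 ≤ (2 * (m₁ * m₂ * q)) ^ 2 * q →
             (q * x ^ 3 ∸ 2 * ((m₁ ⊔ m₂) ^ 3 * x)) ^ 2 ≤ (2 * ((m₁ ⊔ m₂) ^ 2 * q)) ^ 2 * q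
estimate-⊔ {q} {x} {m₁} {m₂} estimate = begin
  (q * x ^ 3 ∸ 2 * (M ^ 3 * x)) ^ 2
    ≤⟨ ^-monoˡ-≤ 2 (∸-monoʳ-≤ (q * x ^ 3) (*-monoʳ-≤ 2 (*-monoˡ-≤ x m₁²m₂≤M³))) ⟩
  (q * x ^ 3 ∸ 2 * (m₁ ^ 2 * m₂ * x)) ^ 2
    ≤⟨ estimate ⟩
  (2 * (m₁ * m₂ * q)) ^ 2 * q
    ≤⟨ *-monoˡ-≤ q (^-monoˡ-≤ 2 (*-monoʳ-≤ 2 (*-monoˡ-≤ q (*-mono-≤ m₁≤M m₂≤M)))) ⟩
  (2 * (M * M * q)) ^ 2 * q
    ≡⟨ cong (λ k → (2 * (k * q)) ^ 2 * q) (cong (M *_) (*-identityʳ M)) ⟨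
  (2 * (M ^ 2 * q)) ^ 2 * q ∎
  where
  open ≤-Reasoning
  M = m₁ ⊔ m₂
  m₁≤M = m≤m⊔n m₁ m₂
  m₂≤M = m≤n⊔m m₁ m₂
  m₁²m₂≤M³ : m₁ ^ 2 * m₂ ≤ M ^ 3
  m₁²m₂≤M³ = begin
    m₁ ^ 2 * m₂  ≤⟨ *-mono-≤ (^-monoˡ-≤ 2 m₁≤M) m₂≤M ⟩
    M ^ 2 * M    ≡⟨ solve 1 (λ M → M :^ 2 :* M := M :^ 3) refl M ⟩
    M ^ 3        ∎

x∈p─q⇒x∉q : ∀ {n} {x : Fin n} {p q : Subset n} → x ∈ p ─ q → x ∉ q
x∈p─q⇒x∉q {p = _ ∷ _} {q = _ ∷ _} (there x∈p─q) (there x∈q) = x∈p─q⇒x∉q x∈p─q x∈q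

∣p∣≤∣p─q∣+∣q∣ : ∀ {n} (p q : Subset n) → ∣ p ∣ ≤ ∣ p ─ q ∣ + ∣ q ∣
∣p∣≤∣p─q∣+∣q∣ []            []            = z≤n
∣p∣≤∣p─q∣+∣q∣ (inside  ∷ p) (inside  ∷ q) = ≤-trans (s≤s (∣p∣≤∣p─q∣+∣q∣ p q)) (≤-reflexive (sym (+-suc ∣ p ─ q ∣ ∣ q ∣)))
∣p∣≤∣p─q∣+∣q∣ (inside  ∷ p) (outside ∷ q) = s≤s (∣p∣≤∣p─q∣+∣q∣ p q)
∣p∣≤∣p─q∣+∣q∣ (outside ∷ p) (inside  ∷ q) = ≤-trans (∣p∣≤∣p─q∣+∣q∣ p q) (+-monoʳ-≤ ∣ p ─ q ∣ (n≤1+n ∣ q ∣))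
∣p∣≤∣p─q∣+∣q∣ (outside ∷ p) (outside ∷ q) = ∣p∣≤∣p─q∣+∣q∣ p q

Empty⇒∣p∣≡0 : ∀ {n} {p : Subset n} → Empty p → ∣ p ∣ ≡ 0
Empty⇒∣p∣≡0 {n} p-empty = trans (cong ∣_∣ (Empty-unique p-empty)) (∣⊥∣≡0 n)

[_] : ∀ {p} {P : Set p} → Dec P → ℕ
[ P? ] = if does P? then 1 else 0

∣p∣≡∑[x∈p] : ∀ {n} (p : Subset n) → ∣ p ∣ ≡ sum (λ x → [ x ∈? p ])
∣p∣≡∑[x∈p] []            = refl
∣p∣≡∑[x∈p] (inside  ∷ p) = cong suc (∣p∣≡∑[x∈p] p)
∣p∣≡∑[x∈p] (outside ∷ p) = ∣p∣≡∑[x∈p] p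

sum-const : ∀ n c → sum {n} (λ _ → c) ≡ n * c
sum-const zero    c = refl
sum-const (suc n) c = cong (c +_) (sum-const n c)

module FiniteSum {X : Set} {n : ℕ} (enum : Fin n ↔ X) where
  open Inverse enum using (to; from; strictlyInverseˡ; strictlyInverseʳ)

  _≟_ : DecidableEquality X
  _≟_ = via-injection (↔⇒↣ (↔-sym enum)) Fin._≟_

  ∑ : (X → ℕ) → ℕ
  ∑ f = sum (f ∘ to)

  ∑-cong : ∀ {f g : X → ℕ} → (∀ x → f x ≡ g x) → ∑ f ≡ ∑ g
  ∑-cong f≗g = sum-cong-≋ (f≗g ∘ to)

  ∑-+ : ∀ (f g : X → ℕ) → ∑ (λ x → f x + g x) ≡ ∑ f + ∑ g
  ∑-+ f g = ∑-distrib-+ (f ∘ to) (g ∘ to)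

  ∑-mono-≤ : ∀ {f g : X → ℕ} → (∀ x → f x ≤ g x) → ∑ f ≤ ∑ g
  ∑-mono-≤ {f} {g} f≤g = begin
    ∑ f                         ≤⟨ m≤m+n (∑ f) _ ⟩
    ∑ f + ∑ (λ x → g x ∸ f x)   ≡⟨ ∑-+ f (λ x → g x ∸ f x) ⟨
    ∑ (λ x → f x + (g x ∸ f x)) ≡⟨ ∑-cong (λ x → m+[n∸m]≡n (f≤g x)) ⟩
    ∑ g                         ∎
    where open ≤-Reasoning

  ∑-*ˡ : ∀ c (f : X → ℕ) → ∑ (λ x → c * f x) ≡ c * ∑ f
  ∑-*ˡ c f = sym (*-distribˡ-sum c (f ∘ to))

  ∑-*ʳ : ∀ c (f : X → ℕ) → ∑ (λ x → f x * c) ≡ ∑ f * c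
  ∑-*ʳ c f = sym (*-distribʳ-sum c (f ∘ to))

  ∑-const : ∀ c → ∑ (λ _ → c) ≡ n * c
  ∑-const = sum-const n

  ∑-comm : ∀ (f : X → X → ℕ) → ∑ (λ x → ∑ (λ y → f x y)) ≡ ∑ (λ y → ∑ (λ x → f x y))
  ∑-comm f = sum-comm (λ i j → f (to i) (to j))

  ∑-reindex : ∀ (σ : X ↔ X) (f : X → ℕ) → ∑ (f ∘ Inverse.to σ) ≡ ∑ f
  ∑-reindex σ f = sym (begin
    sum (f ∘ to)
      ≡⟨ sum-permute (f ∘ to) (↔-trans enum (↔-trans σ (↔-sym enum))) ⟩
    sum (f ∘ to ∘ from ∘ Inverse.to σ ∘ to)
      ≡⟨ ∑-cong (λ x → cong f (strictlyInverseˡ (Inverse.to σ x))) ⟩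
    sum (f ∘ Inverse.to σ ∘ to) ∎)
    where open ≡-Reasoning

  χ : Subset n → X → ℕ
  χ p x = [ from x ∈? p ]

  ∣p∣≡∑χp : ∀ p → ∣ p ∣ ≡ ∑ (χ p)
  ∣p∣≡∑χp p = trans (∣p∣≡∑[x∈p] p) (sum-cong-≋ (λ i → cong (λ j → [ j ∈? p ]) (sym (strictlyInverseʳ i))))

  χ-∈ : ∀ {p x} → from x ∈ p → χ p x ≡ 1
  χ-∈ {p} {x} x∈p with from x ∈? p
  ... | yes _   = refl
  ... | no  x∉p = contradiction x∈p x∉p

  χ*χ≡χ : ∀ p x → χ p x * χ p x ≡ χ p x
  χ*χ≡χ p x with from x ∈? p
  ... | yes _ = refl
  ... | no  _ = refl

  χ-*-≤ : ∀ {p x k m} → (from x ∈ p → k ≤ m) → χ p x * k ≤ m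
  χ-*-≤ {p} {x} {k} k≤m with from x ∈? p
  ... | yes x∈p = ≤-trans (≤-reflexive (+-identityʳ k)) (k≤m x∈p)
  ... | no  _   = z≤n

  χ-*-mono : ∀ {p x k m} → (from x ∈ p → k ≤ m) → χ p x * k ≤ χ p x * m
  χ-*-mono {p} {x} k≤m with from x ∈? p
  ... | yes x∈p = +-monoˡ-≤ 0 (k≤m x∈p)
  ... | no  _   = z≤n

  χ-≤ : ∀ {p x m} → (from x ∈ p → 1 ≤ m) → χ p x ≤ m
  χ-≤ {p} {x} 1≤m = ≤-trans (≤-reflexive (sym (*-identityʳ (χ p x)))) (χ-*-≤ 1≤m)

  ∑-χ* : ∀ p c → ∑ (λ x → χ p x * c) ≡ ∣ p ∣ * c
  ∑-χ* p c = trans (∑-*ʳ c (χ p)) (cong (_* c) (sym (∣p∣≡∑χp p)))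

  Nonempty⇒∃∈ : ∀ {p} → Nonempty p → ∃ λ x → from x ∈ p
  Nonempty⇒∃∈ {p} (i , i∈p) = to i , subst (_∈ p) (sym (strictlyInverseʳ i)) i∈p

  ∑² : (X → X → ℕ) → ℕ
  ∑² f = ∑ λ x → ∑ λ y → f x y

  ∑²-cong : ∀ {f g : X → X → ℕ} → (∀ x y → f x y ≡ g x y) → ∑² f ≡ ∑² g
  ∑²-cong f≗g = ∑-cong λ x → ∑-cong (f≗g x)

  ∑²-mono-≤ : ∀ {f g : X → X → ℕ} → (∀ x y → f x y ≤ g x y) → ∑² f ≤ ∑² g
  ∑²-mono-≤ f≤g = ∑-mono-≤ λ x → ∑-mono-≤ (f≤g x)

  ∑²-+ : ∀ (f g : X → X → ℕ) → ∑² (λ x y → f x y + g x y) ≡ ∑² f + ∑² g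
  ∑²-+ f g = trans (∑-cong λ x → ∑-+ (f x) (g x)) (∑-+ (λ x → ∑ (f x)) (λ x → ∑ (g x)))

  ∑²-*ˡ : ∀ c (f : X → X → ℕ) → ∑² (λ x y → c * f x y) ≡ c * ∑² f
  ∑²-*ˡ c f = trans (∑-cong λ x → ∑-*ˡ c (f x)) (∑-*ˡ c (λ x → ∑ (f x)))

  ∑²-const : ∀ c → ∑² (λ _ _ → c) ≡ n * (n * c)
  ∑²-const c = trans (∑-cong λ _ → ∑-const c) (∑-const (n * c))

  ∑*∑ : ∀ (f g : X → ℕ) → ∑ f * ∑ g ≡ ∑² (λ x y → f x * g y)
  ∑*∑ f g = trans (sym (∑-*ʳ (∑ g) f)) (∑-cong λ x → sym (∑-*ˡ (f x) g))

  ∑²-χ*χ* : ∀ p p′ c → ∑² (λ x y → χ p x * (χ p′ y * c)) ≡ ∣ p ∣ * (∣ p′ ∣ * c)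
  ∑²-χ*χ* p p′ c = trans (∑-cong λ x → trans (∑-*ˡ (χ p x) λ y → χ p′ y * c) (cong (χ p x *_) (∑-χ* p′ c)))
                         (∑-χ* p (∣ p′ ∣ * c))

  ∑²-comm : ∀ (f : X → X → X → X → ℕ) →
            ∑² (λ x y → ∑² (λ z w → f x y z w)) ≡ ∑² (λ z w → ∑² (λ x y → f x y z w))
  ∑²-comm f = begin
    ∑² (λ x y → ∑² (λ z w → f x y z w))         ≡⟨ ∑-cong (λ x → ∑-comm λ y z → ∑ (f x y z)) ⟩
    ∑ (λ x → ∑ λ z → ∑ λ y → ∑ λ w → f x y z w) ≡⟨ ∑-cong (λ x → ∑-cong λ z → ∑-comm λ y w → f x y z w) ⟩
    ∑ (λ x → ∑ λ z → ∑ λ w → ∑ λ y → f x y z w) ≡⟨ ∑-comm (λ x z → ∑ λ w → ∑ λ y → f x y z w) ⟩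
    ∑ (λ z → ∑ λ x → ∑ λ w → ∑ λ y → f x y z w) ≡⟨ ∑-cong (λ z → ∑-comm λ x w → ∑ λ y → f x y z w) ⟩
    ∑² (λ z w → ∑² (λ x y → f x y z w))         ∎
    where open ≡-Reasoning

anyFin-true : ∀ {n} (f : Fin n → Bool) i → f i ≡ true → anyFin f ≡ true
anyFin-true f zero    fi≡true = cong (_∨ anyFin (f ∘ suc)) fi≡true
anyFin-true f (suc i) fi≡true = trans (cong (f zero ∨_) (anyFin-true (f ∘ suc) i fi≡true)) (∨-zeroʳ (f zero))

module _ (F : FiniteField) where
  open FiniteField F renaming (_+_ to _⊕_; _*_ to _⊗_; -_ to ⊖_)
  open Inverse enum using (to; from; strictlyInverseˡ)
  open FiniteSum enum

  private
    ring : CommutativeRing _ _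
    ring = record { isCommutativeRing = isCommutativeRing }

  open CommutativeRing ring using ()
    renaming (+-comm to ⊕-comm; +-assoc to ⊕-assoc; *-assoc to ⊗-assoc; *-comm to ⊗-comm;
              *-identityˡ to ⊗-identityˡ; distribˡ to ⊗-distribˡ-⊕)
  open RingProperties (CommutativeRing.ring ring)
    using (\\-leftDividesˡ; \\-leftDividesʳ; x∙y⁻¹≈ε⇒x≈y; xyx⁻¹≈y; x[y-z]≈xy-xz; -‿distribˡ-*; -‿injective; -0#≈0#)

  translation : Carrier → Carrier ↔ Carrier
  translation w = mk↔ₛ′ (w ⊕_) (⊖ w ⊕_) (\\-leftDividesˡ w) (\\-leftDividesʳ w)

  dilation : ∀ c → c ≢ 0# → Carrier ↔ Carrier
  dilation c c≢0 with c⁻¹ , c*c⁻¹≡1 ← inverse c c≢0 =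
    mk↔ₛ′ (c ⊗_) (c⁻¹ ⊗_) (cancel c c⁻¹ c*c⁻¹≡1) (cancel c⁻¹ c (trans (⊗-comm c⁻¹ c) c*c⁻¹≡1))
    where
    cancel : ∀ a b → a ⊗ b ≡ 1# → ∀ v → a ⊗ (b ⊗ v) ≡ v
    cancel a b ab≡1 v = trans (sym (⊗-assoc a b v)) (trans (cong (_⊗ v) ab≡1) (⊗-identityˡ v))

  ∑-translate : ∀ w (f : Carrier → ℕ) → ∑ (λ t → f (w ⊕ t)) ≡ ∑ f
  ∑-translate w = ∑-reindex (translation w)

  ∑-dilate : ∀ {c} → c ≢ 0# → ∀ (f : Carrier → ℕ) → ∑ (λ t → f (c ⊗ t)) ≡ ∑ f
  ∑-dilate c≢0 = ∑-reindex (dilation _ c≢0)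

  ∑χ-translate : ∀ p w → ∑ (λ t → χ p (w ⊕ t)) ≡ ∣ p ∣
  ∑χ-translate p w = trans (∑-translate w (χ p)) (sym (∣p∣≡∑χp p))

  ∈-opSet : ∀ (_⊙_ : Carrier → Carrier → Carrier) {A a b} → from a ∈ A → from b ∈ A →
            from (a ⊙ b) ∈ opSet F _⊙_ A
  ∈-opSet _⊙_ {A} {a} {b} a∈A b∈A = lookup⇒[]= _ _ (begin
    lookup (opSet F _⊙_ A) (from (a ⊙ b))  ≡⟨ lookup∘tabulate _ (from (a ⊙ b)) ⟩
    anyFin (λ i → anyFin λ j → lookup A i ∧ lookup A j ∧ ⌊ from (to i ⊙ to j) Fin.≟ from (a ⊙ b) ⌋)
      ≡⟨ anyFin-true _ (from a) (anyFin-true _ (from b) witness) ⟩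
    true ∎)
    where
    open ≡-Reasoning
    witness : lookup A (from a) ∧ lookup A (from b) ∧ ⌊ from (to (from a) ⊙ to (from b)) Fin.≟ from (a ⊙ b) ⌋ ≡ true
    witness rewrite []=⇒lookup a∈A | []=⇒lookup b∈A | strictlyInverseˡ a | strictlyInverseˡ b =
      trans (isYes≗does (from (a ⊙ b) Fin.≟ _)) (dec-true (from (a ⊙ b) Fin.≟ _) refl)

  module Incidences (S T : Subset q) where

    N : ℕ
    N = ∣ S ∣ * ∣ T ∣

    incidences : Carrier → Carrier → ℕ
    incidences s t = ∑ λ u → χ S u * χ T (s ⊗ u ⊕ t)

    ∑²-incidences : ∑² incidences ≡ q * N
    ∑²-incidences = begin
      ∑² incidences
        ≡⟨ ∑-cong (λ s → ∑-comm λ t u → χ S u * χ T (s ⊗ u ⊕ t)) ⟩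
      ∑ (λ s → ∑ λ u → ∑ λ t → χ S u * χ T (s ⊗ u ⊕ t))
        ≡⟨ ∑²-cong (λ s u → ∑-*ˡ (χ S u) λ t → χ T (s ⊗ u ⊕ t)) ⟩
      ∑ (λ s → ∑ λ u → χ S u * ∑ λ t → χ T (s ⊗ u ⊕ t))
        ≡⟨ ∑²-cong (λ s u → cong (χ S u *_) (∑χ-translate T (s ⊗ u))) ⟩
      ∑ (λ s → ∑ λ u → χ S u * ∣ T ∣)
        ≡⟨ ∑-cong (λ s → ∑-χ* S ∣ T ∣) ⟩
      ∑ (λ s → N)
        ≡⟨ ∑-const N ⟩
      q * N ∎
      where open ≡-Reasoning

    commonLines : Carrier → Carrier → ℕ
    commonLines u u′ = ∑² λ s t → χ T (s ⊗ u ⊕ t) * χ T (s ⊗ u′ ⊕ t)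

    commonLines-diag : ∀ u → commonLines u u ≡ q * ∣ T ∣
    commonLines-diag u = begin
      commonLines u u                 ≡⟨ ∑²-cong (λ s t → χ*χ≡χ T (s ⊗ u ⊕ t)) ⟩
      ∑ (λ s → ∑ λ t → χ T (s ⊗ u ⊕ t)) ≡⟨ ∑-cong (λ s → ∑χ-translate T (s ⊗ u)) ⟩
      ∑ (λ s → ∣ T ∣)                 ≡⟨ ∑-const ∣ T ∣ ⟩
      q * ∣ T ∣                       ∎
      where open ≡-Reasoning

    -- The shear t ↦ t − s u turns the second condition into a dilation of s by u′ − u ≢ 0.
    commonLines-off-diag : ∀ {u u′} → u ≢ u′ → commonLines u u′ ≡ ∣ T ∣ * ∣ T ∣
    commonLines-off-diag {u} {u′} u≢u′ = begin
      commonLines u u′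
        ≡⟨ ∑-cong (λ s → ∑-translate (⊖ (s ⊗ u)) λ t → χ T (s ⊗ u ⊕ t) * χ T (s ⊗ u′ ⊕ t)) ⟨
      ∑ (λ s → ∑ λ t → χ T (s ⊗ u ⊕ (⊖ (s ⊗ u) ⊕ t)) * χ T (s ⊗ u′ ⊕ (⊖ (s ⊗ u) ⊕ t)))
        ≡⟨ ∑²-cong (λ s t → cong₂ (λ y y′ → χ T y * χ T y′) (\\-leftDividesˡ (s ⊗ u) t) (shear s t)) ⟩
      ∑ (λ s → ∑ λ t → χ T t * χ T (d ⊗ s ⊕ t))
        ≡⟨ ∑-comm (λ s t → χ T t * χ T (d ⊗ s ⊕ t)) ⟩
      ∑ (λ t → ∑ λ s → χ T t * χ T (d ⊗ s ⊕ t))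
        ≡⟨ ∑-cong (λ t → ∑-*ˡ (χ T t) λ s → χ T (d ⊗ s ⊕ t)) ⟩
      ∑ (λ t → χ T t * ∑ λ s → χ T (d ⊗ s ⊕ t))
        ≡⟨ ∑-cong (λ t → cong (χ T t *_) (∑-line t)) ⟩
      ∑ (λ t → χ T t * ∣ T ∣)
        ≡⟨ ∑-χ* T ∣ T ∣ ⟩
      ∣ T ∣ * ∣ T ∣ ∎
      where
      open ≡-Reasoning
      d = u′ ⊕ ⊖ u
      d≢0 : d ≢ 0#
      d≢0 d≡0 = u≢u′ (sym (x∙y⁻¹≈ε⇒x≈y u′ u d≡0))
      ∑-line : ∀ t → ∑ (λ s → χ T (d ⊗ s ⊕ t)) ≡ ∣ T ∣
      ∑-line t = begin
        ∑ (λ s → χ T (d ⊗ s ⊕ t)) ≡⟨ ∑-dilate d≢0 (λ s → χ T (s ⊕ t)) ⟩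
        ∑ (λ s → χ T (s ⊕ t))     ≡⟨ ∑-cong (λ s → cong (χ T) (⊕-comm s t)) ⟩
        ∑ (λ s → χ T (t ⊕ s))     ≡⟨ ∑χ-translate T t ⟩
        ∣ T ∣                     ∎
      shear : ∀ s t → s ⊗ u′ ⊕ (⊖ (s ⊗ u) ⊕ t) ≡ d ⊗ s ⊕ t
      shear s t = begin
        s ⊗ u′ ⊕ (⊖ (s ⊗ u) ⊕ t) ≡⟨ ⊕-assoc (s ⊗ u′) (⊖ (s ⊗ u)) t ⟨
        s ⊗ u′ ⊕ ⊖ (s ⊗ u) ⊕ t   ≡⟨ cong (_⊕ t) (x[y-z]≈xy-xz s u′ u) ⟨
        s ⊗ d ⊕ t                ≡⟨ cong (_⊕ t) (⊗-comm s d) ⟩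
        d ⊗ s ⊕ t                ∎

    ∑²-incidences²≡∑²-commonLines :
      ∑² (λ s t → incidences s t ^ 2) ≡ ∑² (λ u u′ → χ S u * (χ S u′ * commonLines u u′))
    ∑²-incidences²≡∑²-commonLines = begin
      ∑² (λ s t → incidences s t ^ 2)
        ≡⟨ ∑²-cong (λ s t → trans (cong (incidences s t *_) (*-identityʳ _)) (∑*∑ (incident s t) (incident s t))) ⟩
      ∑² (λ s t → ∑² λ u u′ → incident s t u * incident s t u′)
        ≡⟨ ∑²-comm (λ s t u u′ → incident s t u * incident s t u′) ⟩
      ∑² (λ u u′ → ∑² λ s t → incident s t u * incident s t u′)
        ≡⟨ ∑²-cong (λ u u′ → trans (∑²-cong λ s t → interchange (χ S u) (χ T (s ⊗ u ⊕ t)) (χ S u′) (χ T (s ⊗ u′ ⊕ t)))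
                                   (∑²-*ˡ (χ S u * χ S u′) λ s t → χ T (s ⊗ u ⊕ t) * χ T (s ⊗ u′ ⊕ t))) ⟩
      ∑² (λ u u′ → χ S u * χ S u′ * commonLines u u′)
        ≡⟨ ∑²-cong (λ u u′ → *-assoc (χ S u) (χ S u′) (commonLines u u′)) ⟩
      ∑² (λ u u′ → χ S u * (χ S u′ * commonLines u u′)) ∎
      where
      open ≡-Reasoning
      incident : Carrier → Carrier → Carrier → ℕ
      incident s t u = χ S u * χ T (s ⊗ u ⊕ t)
      interchange : ∀ a b c d → a * b * (c * d) ≡ a * c * (b * d)
      interchange = solve-∀

    commonLines-≤ : ∀ u u′ → χ S u * (χ S u′ * commonLines u u′) ≤
                    χ S u * (χ ⁅ from u ⁆ u′ * (q * ∣ T ∣)) + χ S u * (χ S u′ * (∣ T ∣ * ∣ T ∣))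
    commonLines-≤ u u′ with u ≟ u′
    ... | no u≢u′ rewrite commonLines-off-diag u≢u′ = m≤n+m _ _
    ... | yes refl rewrite commonLines-diag u | χ-∈ {⁅ from u ⁆} {u} (x∈⁅x⁆ (from u)) =
      ≤-trans (*-monoʳ-≤ (χ S u) (χ-*-≤ λ _ → ≤-reflexive (sym (*-identityˡ (q * ∣ T ∣))))) (m≤m+n _ _)

    ∑²-incidences² : ∑² (λ s t → incidences s t ^ 2) ≤ q * N + N * N
    ∑²-incidences² = begin
      ∑² (λ s t → incidences s t ^ 2)
        ≡⟨ ∑²-incidences²≡∑²-commonLines ⟩
      ∑² (λ u u′ → χ S u * (χ S u′ * commonLines u u′))
        ≤⟨ ∑²-mono-≤ commonLines-≤ ⟩
      ∑² (λ u u′ → diagonal u u′ + χ S u * (χ S u′ * (∣ T ∣ * ∣ T ∣)))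
        ≡⟨ ∑²-+ diagonal (λ u u′ → χ S u * (χ S u′ * (∣ T ∣ * ∣ T ∣))) ⟩
      ∑² diagonal + ∑² (λ u u′ → χ S u * (χ S u′ * (∣ T ∣ * ∣ T ∣)))
        ≡⟨ cong₂ _+_ ∑²-diagonal (∑²-χ*χ* S S (∣ T ∣ * ∣ T ∣)) ⟩
      ∣ S ∣ * (q * ∣ T ∣) + ∣ S ∣ * (∣ S ∣ * (∣ T ∣ * ∣ T ∣))
        ≡⟨ collect q ∣ S ∣ ∣ T ∣ ⟩
      q * N + N * N ∎
      where
      open ≤-Reasoning
      diagonal : Carrier → Carrier → ℕ
      diagonal u u′ = χ S u * (χ ⁅ from u ⁆ u′ * (q * ∣ T ∣))
      ∑²-diagonal : ∑² diagonal ≡ ∣ S ∣ * (q * ∣ T ∣)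
      ∑²-diagonal = begin-equality
        ∑² diagonal
          ≡⟨ ∑-cong (λ u → ∑-*ˡ (χ S u) λ u′ → χ ⁅ from u ⁆ u′ * (q * ∣ T ∣)) ⟩
        ∑ (λ u → χ S u * ∑ λ u′ → χ ⁅ from u ⁆ u′ * (q * ∣ T ∣))
          ≡⟨ ∑-cong (λ u → cong (χ S u *_) (∑-χ* ⁅ from u ⁆ (q * ∣ T ∣))) ⟩
        ∑ (λ u → χ S u * (∣ ⁅ from u ⁆ ∣ * (q * ∣ T ∣)))
          ≡⟨ ∑-cong (λ u → cong (λ k → χ S u * (k * (q * ∣ T ∣))) (∣⁅x⁆∣≡1 (from u))) ⟩
        ∑ (λ u → χ S u * (1 * (q * ∣ T ∣)))
          ≡⟨ ∑-χ* S (1 * (q * ∣ T ∣)) ⟩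
        ∣ S ∣ * (1 * (q * ∣ T ∣))
          ≡⟨ cong (∣ S ∣ *_) (*-identityˡ (q * ∣ T ∣)) ⟩
        ∣ S ∣ * (q * ∣ T ∣) ∎
      collect : ∀ q s t → s * (q * t) + s * (s * (t * t)) ≡ q * (s * t) + s * t * (s * t)
      collect = solve-∀

    deviation : Carrier → Carrier → ℕ
    deviation s t = ∣ q * incidences s t - N ∣

    -- The variance identity is used in the additive form ∣m - n∣² + 2mn = m² + n², with the
    -- cross term cancelled at the end, because subtraction on ℕ is truncated.
    ∑²-deviation² : ∑² (λ s t → deviation s t ^ 2) ≤ q ^ 3 * N
    ∑²-deviation² = +-cancelʳ-≤ cross _ _ (begin
      ∑² (λ s t → deviation s t ^ 2) + cross
        ≡⟨ cong (∑² (λ s t → deviation s t ^ 2) +_) ∑²-cross ⟨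
      ∑² (λ s t → deviation s t ^ 2) + ∑² (λ s t → 2 * (q * incidences s t * N))
        ≡⟨ ∑²-+ (λ s t → deviation s t ^ 2) (λ s t → 2 * (q * incidences s t * N)) ⟨
      ∑² (λ s t → deviation s t ^ 2 + 2 * (q * incidences s t * N))
        ≡⟨ ∑²-cong (λ s t → ∣m-n∣^2+2mn≡m^2+n^2 (q * incidences s t) N) ⟩
      ∑² (λ s t → (q * incidences s t) ^ 2 + N ^ 2)
        ≡⟨ ∑²-+ (λ s t → (q * incidences s t) ^ 2) (λ _ _ → N ^ 2) ⟩
      ∑² (λ s t → (q * incidences s t) ^ 2) + ∑² (λ _ _ → N ^ 2)
        ≡⟨ cong₂ _+_ (trans (∑²-cong λ s t → *-^2 q (incidences s t)) (∑²-*ˡ (q ^ 2) λ s t → incidences s t ^ 2))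
                     (∑²-const (N ^ 2)) ⟩
      q ^ 2 * ∑² (λ s t → incidences s t ^ 2) + q * (q * N ^ 2)
        ≤⟨ +-monoˡ-≤ (q * (q * N ^ 2)) (*-monoʳ-≤ (q ^ 2) ∑²-incidences²) ⟩
      q ^ 2 * (q * N + N * N) + q * (q * N ^ 2)
        ≡⟨ collect q N ⟩
      q ^ 3 * N + cross ∎)
      where
      open ≤-Reasoning
      cross : ℕ
      cross = 2 * q * N * (q * N)
      ∑²-cross : ∑² (λ s t → 2 * (q * incidences s t * N)) ≡ cross
      ∑²-cross = begin-equality
        ∑² (λ s t → 2 * (q * incidences s t * N))
          ≡⟨ ∑²-cong (λ s t → solve 3 (λ q N n → con 2 :* (q :* n :* N)
                                              := con 2 :* q :* N :* n) refl q N (incidences s t)) ⟩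
        ∑² (λ s t → 2 * q * N * incidences s t)
          ≡⟨ ∑²-*ˡ (2 * q * N) incidences ⟩
        2 * q * N * ∑² incidences
          ≡⟨ cong (2 * q * N *_) ∑²-incidences ⟩
        cross ∎
      *-^2 : ∀ a b → (a * b) ^ 2 ≡ a ^ 2 * b ^ 2
      *-^2 = solve 2 (λ a b → (a :* b) :^ 2 := a :^ 2 :* b :^ 2) refl
      collect : ∀ q N → q ^ 2 * (q * N + N * N) + q * (q * N ^ 2) ≡ q ^ 3 * N + 2 * q * N * (q * N)
      collect = solve 2 (λ q N → q :^ 2 :* (q :* N :+ N :* N) :+ q :* (q :* N :^ 2)
                              := q :^ 3 :* N :+ con 2 :* q :* N :* (q :* N)) refl

  module SumProduct (A : Subset q) where
    open Incidences (sumset F A) (prodset F A)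

    A* : Subset q
    A* = A ─ ⁅ from 0# ⁆

    ∈A*⇒≢0 : ∀ {c} → from c ∈ A* → c ≢ 0#
    ∈A*⇒≢0 c∈A* c≡0 = x∉⁅y⁆⇒x≢y (x∈p─q⇒x∉q c∈A*) (cong from c≡0)

    ∣A∣≤∣A*∣+1 : ∣ A ∣ ≤ ∣ A* ∣ + 1
    ∣A∣≤∣A*∣+1 = subst (λ k → ∣ A ∣ ≤ ∣ A* ∣ + k) (∣⁅x⁆∣≡1 (from 0#)) (∣p∣≤∣p─q∣+∣q∣ A ⁅ from 0# ⁆)

    ∣A∣≤∣A+A∣ : ∣ A ∣ ≤ ∣ sumset F A ∣
    ∣A∣≤∣A+A∣ with nonempty? A
    ... | no A-empty = ≤-trans (≤-reflexive (Empty⇒∣p∣≡0 A-empty)) z≤n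
    ... | yes A-nonempty with b , b∈A ← Nonempty⇒∃∈ A-nonempty = begin
      ∣ A ∣
        ≡⟨ ∣p∣≡∑χp A ⟩
      ∑ (χ A)
        ≤⟨ ∑-mono-≤ (λ a → χ-≤ {x = a} λ a∈A → ≤-reflexive (sym (χ-∈ (∈-opSet _⊕_ b∈A a∈A)))) ⟩
      ∑ (λ a → χ (sumset F A) (b ⊕ a))
        ≡⟨ ∑χ-translate (sumset F A) b ⟩
      ∣ sumset F A ∣ ∎
      where open ≤-Reasoning

    ∣A∣≤∣A·A∣ : ∣ A ∣ ≤ ∣ prodset F A ∣
    ∣A∣≤∣A·A∣ with nonempty? A*
    ... | yes A*-nonempty with c , c∈A* ← Nonempty⇒∃∈ A*-nonempty = begin
      ∣ A ∣
        ≡⟨ ∣p∣≡∑χp A ⟩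
      ∑ (χ A)
        ≤⟨ ∑-mono-≤ (λ a → χ-≤ {x = a} λ a∈A → ≤-reflexive (sym (χ-∈ (∈-opSet _⊗_ (p─q⊆p A _ c∈A*) a∈A)))) ⟩
      ∑ (λ a → χ (prodset F A) (c ⊗ a))
        ≡⟨ ∑-dilate (∈A*⇒≢0 c∈A*) (χ (prodset F A)) ⟩
      ∑ (χ (prodset F A))
        ≡⟨ ∣p∣≡∑χp (prodset F A) ⟨
      ∣ prodset F A ∣ ∎
      where open ≤-Reasoning
    ... | no A*-empty with nonempty? A
    ...   | no A-empty = ≤-trans (≤-reflexive (Empty⇒∣p∣≡0 A-empty)) z≤n
    ...   | yes A-nonempty with b , b∈A ← Nonempty⇒∃∈ A-nonempty = begin
      ∣ A ∣           ≤⟨ ∣A∣≤∣A*∣+1 ⟩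
      ∣ A* ∣ + 1      ≡⟨ cong (_+ 1) (Empty⇒∣p∣≡0 A*-empty) ⟩
      1               ≤⟨ ≤-trans (s≤s z≤n) (x∈p⇒∣p-x∣<∣p∣ (∈-opSet _⊗_ b∈A b∈A)) ⟩
      ∣ prodset F A ∣ ∎
      where open ≤-Reasoning

    rich-line : ∀ {b c} → from b ∈ A → from c ∈ A → ∣ A ∣ ≤ incidences c (⊖ c ⊗ b)
    rich-line {b} {c} b∈A c∈A = begin
      ∣ A ∣
        ≡⟨ ∣p∣≡∑χp A ⟩
      ∑ (χ A)
        ≤⟨ ∑-mono-≤ (λ a → χ-≤ {x = a} λ a∈A → ≤-reflexive (sym (on-grid a∈A))) ⟩
      ∑ (λ a → χ (sumset F A) (b ⊕ a) * χ (prodset F A) (c ⊗ a))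
        ≡⟨ ∑-cong (λ a → cong (λ y → χ (sumset F A) (b ⊕ a) * χ (prodset F A) y) (on-line a)) ⟨
      ∑ (λ a → χ (sumset F A) (b ⊕ a) * χ (prodset F A) (c ⊗ (b ⊕ a) ⊕ ⊖ c ⊗ b))
        ≡⟨ ∑-translate b (λ u → χ (sumset F A) u * χ (prodset F A) (c ⊗ u ⊕ ⊖ c ⊗ b)) ⟩
      incidences c (⊖ c ⊗ b) ∎
      where
      open ≤-Reasoning
      on-grid : ∀ {a} → from a ∈ A → χ (sumset F A) (b ⊕ a) * χ (prodset F A) (c ⊗ a) ≡ 1
      on-grid a∈A = cong₂ _*_ (χ-∈ (∈-opSet _⊕_ b∈A a∈A)) (χ-∈ (∈-opSet _⊗_ c∈A a∈A))
      on-line : ∀ a → c ⊗ (b ⊕ a) ⊕ ⊖ c ⊗ b ≡ c ⊗ a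
      on-line a = trans (cong₂ _⊕_ (⊗-distribˡ-⊕ c b a) (sym (-‿distribˡ-* c b))) (xyx⁻¹≈y (c ⊗ b) (c ⊗ a))

    rich-lines-bound : ∣ A ∣ * ∣ A* ∣ * (q * ∣ A ∣ ∸ N) ^ 2 ≤ q ^ 3 * N
    rich-lines-bound = begin
      ∣ A ∣ * ∣ A* ∣ * excess ^ 2
        ≡⟨ *-assoc ∣ A ∣ ∣ A* ∣ (excess ^ 2) ⟩
      ∣ A ∣ * (∣ A* ∣ * excess ^ 2)
        ≡⟨ ∑²-χ*χ* A A* (excess ^ 2) ⟨
      ∑² (λ b c → χ A b * (χ A* c * excess ^ 2))
        ≤⟨ ∑²-mono-≤ (λ b c → χ-*-≤ {x = b} λ b∈A → χ-*-mono {x = c} λ c∈A* →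
                      ^-monoˡ-≤ 2 (excess≤deviation b∈A (p─q⊆p A _ c∈A*))) ⟩
      ∑² (λ b c → χ A* c * deviation c (⊖ c ⊗ b) ^ 2)
        ≡⟨ ∑-comm (λ b c → χ A* c * deviation c (⊖ c ⊗ b) ^ 2) ⟩
      ∑ (λ c → ∑ λ b → χ A* c * deviation c (⊖ c ⊗ b) ^ 2)
        ≡⟨ ∑-cong (λ c → ∑-*ˡ (χ A* c) λ b → deviation c (⊖ c ⊗ b) ^ 2) ⟩
      ∑ (λ c → χ A* c * ∑ λ b → deviation c (⊖ c ⊗ b) ^ 2)
        ≤⟨ ∑-mono-≤ (λ c → χ-*-≤ {x = c} λ c∈A* →
                     ≤-reflexive (∑-dilate (-≢0 (∈A*⇒≢0 c∈A*)) λ t → deviation c t ^ 2)) ⟩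
      ∑² (λ c t → deviation c t ^ 2)
        ≤⟨ ∑²-deviation² ⟩
      q ^ 3 * N ∎
      where
      open ≤-Reasoning
      excess = q * ∣ A ∣ ∸ N
      excess≤deviation : ∀ {b c} → from b ∈ A → from c ∈ A → excess ≤ deviation c (⊖ c ⊗ b)
      excess≤deviation b∈A c∈A = ≤-trans (∸-monoˡ-≤ N (*-monoʳ-≤ q (rich-line b∈A c∈A))) (m∸n≤∣m-n∣ _ N)
      -≢0 : ∀ {c} → c ≢ 0# → ⊖ c ≢ 0#
      -≢0 c≢0 -c≡0 = c≢0 (-‿injective (trans -c≡0 (sym -0#≈0#)))

  sum-product-estimate : ∀ (A : Subset q) →
    (q * ∣ A ∣ ^ 3 ∸ 2 * (∣ sumset F A ∣ ^ 2 * ∣ prodset F A ∣ * ∣ A ∣)) ^ 2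
      ≤ (2 * (∣ sumset F A ∣ * ∣ prodset F A ∣ * q)) ^ 2 * q
  sum-product-estimate A =
    x²e²≤2q³N⇒estimate ∣A∣≤∣A+A∣ ∣A∣²≤N (xye²≤q³N⇒x²e²≤2q³N {q} rich-lines-bound ∣A∣≤∣A*∣+1 ∣A∣²≤N)
    where
    open SumProduct A
    ∣A∣²≤N : ∣ A ∣ ^ 2 ≤ ∣ sumset F A ∣ * ∣ prodset F A ∣
    ∣A∣²≤N = ≤-trans (≤-reflexive (cong (∣ A ∣ *_) (*-identityʳ ∣ A ∣))) (*-mono-≤ ∣A∣≤∣A+A∣ ∣A∣≤∣A·A∣)

  max-sum-product-bound : ∀ (A : Subset q) {a b} .{{_ : NonZero a}} .{{_ : NonZero b}} →
    b ^ 10 * ∣ A ∣ ^ 10 ≤ a ^ 10 * q ^ 7 →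
    b ^ 4 * ∣ A ∣ ^ 6 ≤ (2 * a * b) ^ 4 * (∣ sumset F A ∣ ⊔ ∣ prodset F A ∣) ^ 4 * q
  max-sum-product-bound A =
    estimate⇒b⁴x⁶≤[2ab]⁴M⁴q {q} {∣ A ∣} {∣ sumset F A ∣ ⊔ ∣ prodset F A ∣}
      (estimate-⊔ {q} {∣ A ∣} {∣ sumset F A ∣} {∣ prodset F A ∣} (sum-product-estimate A))

open FiniteField using (q)

theorem1p1 :
  (Σ ℕ λ C → 0 < C ×
    ((F : FiniteField) (A : Subset (q F)) →
      let x = ∣ A ∣
          m₁ = ∣ sumset F A ∣
          m₂ = ∣ prodset F A ∣
      in ((q F * x ^ 3) ∸ (C * (m₁ ^ 2 * m₂ * x))) ^ 2
           ≤ (C * (m₁ * m₂ * q F)) ^ 2 * q F))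
  ×
  ((a₁ b₁ a₂ b₂ : ℕ) → 0 < a₁ → 0 < b₁ → 0 < a₂ → 0 < b₂ →
    Σ ℕ λ e → Σ ℕ λ f → 0 < e × 0 < f ×
      ((F : FiniteField) (A : Subset (q F)) →
        let x = ∣ A ∣
            m₁ = ∣ sumset F A ∣
            m₂ = ∣ prodset F A ∣
        in a₁ ^ 2 * q F ≤ b₁ ^ 2 * x ^ 2 →
           b₂ ^ 10 * x ^ 10 ≤ a₂ ^ 10 * q F ^ 7 →
           e ^ 4 * x ^ 6 ≤ f ^ 4 * (m₁ ⊔ m₂) ^ 4 * q F))
-- e / f = 1 / (2 a₂).
theorem1p1 = (2 , s≤s z≤n , sum-product-estimate) ,
  λ a₁ b₁ a₂ b₂ _ _ 0<a₂ 0<b₂ →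
    b₂ , 2 * a₂ * b₂ , 0<b₂ ,
    *-mono-≤ {1} {2 * a₂} {1} {b₂} (*-mono-≤ {1} {2} {1} {a₂} (s≤s z≤n) 0<a₂) 0<b₂ ,
    λ F A _ → max-sum-product-bound F A {{>-nonZero 0<a₂}} {{>-nonZero 0<b₂}}
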